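{- In the hybrid model described in the context, for all integers $n\ge 2$ and $1\le m\le n-1$ there is an instance of the Shape Reconfiguration Problem with $n$ tiles and $m=|\mathcal{I}\setminus\mathcal{T}|$ supply tiles such that every sequence of legal agent actions that transforms the tile set from $\mathcal{I}$ into $\mathcal{T}$ (keeping every configuration connected) has length $\Omega(mn)$. In particular, the agent requires $\Omega(mn)$ time steps to solve the Shape Reconfiguration Problem in general.
   Context: The triangular lattice $G=(V,E)$ has node set $V=\{(x,y)\in\mathbb{Z}^2: x+y \text{ even}\}$; the six compass directions N, NE, SE, S, SW, NW correspond to the vectors $(0,-2),(1,-1),(1,1),(0,2),(-1,1),(-1,-1)$. A set $S\subseteq V$ is connected if $G[S]$ is connected. Nodes may be occupied by passive, indistinguishable tiles (at most one per node); the set of tiled nodes is $\mathcal{P}$. A single agent occupies one node $p$, can carry at most one tile, and per time step performs one action: move to an adjacent node, lift the tile at its node (if not carrying one), or place its carried tile at its (untiled) node. A configuration $(\mathcal{P},p)$ is connected if $\mathcal{P}$ is connected, or if the agent carries a tile and $\mathcal{P}\cup\{p\}$ is connected; every configuration in an execution must be connected. An instance of the Shape Reconfiguration Problem consists of connected sets $\mathcal{I},\mathcal{T}\subseteq V$ with $|\mathcal{I}|=|\mathcal{T}|=n$, such that $\mathcal{I}\cap\mathcal{T}$ is non-empty and connected, and an initial agent position $p^0\in\mathcal{I}$; initially $\mathcal{P}=\mathcal{I}$, and the instance is solved when $\mathcal{P}=\mathcal{T}$. The number of supply tiles is $m=|\mathcal{I}\setminus\mathcal{T}|$. -}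

module Defs where

open import Data.Nat using (ℕ; zero; suc; _+_; _*_; _∸_; _≤_)
open import Data.Integer as ℤ using (ℤ; +_; -[1+_])
open import Data.Integer.Properties as ℤP using ()
open import Data.Product using (Σ; ∃; _×_; _,_)
open import Data.Product.Properties using (≡-dec)
open import Data.Bool using (Bool; true; false; if_then_else_; _∧_; not)
open import Data.List using (List; length)
open import Data.List.Membership.Propositional using (_∈_)
open import Data.List.Relation.Unary.Unique.Propositional using (Unique)
open import Data.Sum using (_⊎_)
open import Relation.Nullary using (does)
open import Relation.Binary.PropositionalEquality using (_≡_)

-- Points of ℤ²; the lattice nodes are those with x + y even.
Node : Set
Node = ℤ × ℤ

InV : Node → Set
InV (x , y) = ℤ.∣ x ℤ.+ y ∣ Data.Nat.% 2 ≡ 0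
  where import Data.Nat

_≟ₙ_ : (u v : Node) → Relation.Nullary.Dec (u ≡ v)
_≟ₙ_ = ≡-dec ℤP._≟_ ℤP._≟_
  where import Relation.Nullary

data Dir : Set where
  N NE SE S SW NW : Dir

vec : Dir → Node
vec N  = (+ 0 , ℤ.- (+ 2))
vec NE = (+ 1 , ℤ.- (+ 1))
vec SE = (+ 1 , + 1)
vec S  = (+ 0 , + 2)
vec SW = (ℤ.- (+ 1) , + 1)
vec NW = (ℤ.- (+ 1) , ℤ.- (+ 1))

_⊕_ : Node → Node → Node
(a , b) ⊕ (c , d) = (a ℤ.+ c , b ℤ.+ d)

Adj : Node → Node → Set
Adj u v = ∃ λ d → v ≡ u ⊕ vec d

NodeSet : Set
NodeSet = Node → Bool

_∈ₛ_ : Node → NodeSet → Set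
v ∈ₛ P = P v ≡ true

_∩_ : NodeSet → NodeSet → NodeSet
(A ∩ B) v = A v ∧ B v

_∖_ : NodeSet → NodeSet → NodeSet
(A ∖ B) v = A v ∧ not (B v)

upd : NodeSet → Node → Bool → NodeSet
upd P p b v = if does (v ≟ₙ p) then b else P v

data PathIn (A : NodeSet) : Node → Node → Set where
  here : ∀ {u} → u ∈ₛ A → PathIn A u u
  there : ∀ {u w v} → u ∈ₛ A → Adj u w → PathIn A w v → PathIn A u v

Connected : NodeSet → Set
Connected A = ∀ u v → u ∈ₛ A → v ∈ₛ A → PathIn A u v

SubsetV : NodeSet → Set
SubsetV A = ∀ v → v ∈ₛ A → InV v

Card : NodeSet → ℕ → Set
Card A k = Σ (List Node) λ L → Unique L × length L ≡ k
           × (∀ v → (v ∈ₛ A → v ∈ L) × (v ∈ L → v ∈ₛ A))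

NonEmpty : NodeSet → Set
NonEmpty A = ∃ λ v → v ∈ₛ A

record Config : Set where
  constructor ⟨_,_,_⟩
  field
    tiles : NodeSet
    pos   : Node
    carry : Bool
open Config public

ConnConfig : Config → Set
ConnConfig ⟨ P , p , false ⟩ = Connected P
ConnConfig ⟨ P , p , true ⟩ = Connected P ⊎ Connected (upd P p true)

data Step : Config → Config → Set where
  move  : ∀ {P p q c} → Adj p q → Step ⟨ P , p , c ⟩ ⟨ P , q , c ⟩
  lift  : ∀ {P p} → P p ≡ true → Step ⟨ P , p , false ⟩ ⟨ upd P p false , p , true ⟩
  place : ∀ {P p} → P p ≡ false → Step ⟨ P , p , true ⟩ ⟨ upd P p true , p , false ⟩

data Run : Config → Config → ℕ → Set where
  done : ∀ {c} → ConnConfig c → Run c c 0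
  step : ∀ {c c' d k} → ConnConfig c → Step c c' → Run c' d k → Run c d (suc k)

record Instance (n m : ℕ) : Set where
  field
    I T    : NodeSet
    p0     : Node
    I⊆V    : SubsetV I
    T⊆V    : SubsetV T
    I-conn : Connected I
    T-conn : Connected T
    I-card : Card I n
    T-card : Card T n
    I∩T-ne : NonEmpty (I ∩ T)
    I∩T-conn : Connected (I ∩ T)
    supply : Card (I ∖ T) m
    p0∈I   : p0 ∈ₛ I
open Instance public

initial : ∀ {n m} → Instance n m → Config
initial inst = ⟨ I inst , p0 inst , false ⟩

Solves : ∀ {n m} → Instance n m → ℕ → Set
Solves inst k = Σ Config λ d → Run (initial inst) d k × (∀ v → tiles d v ≡ T inst v)

{-# OPTIONS --safe #-}
-- The hard instance is a column of n tiles at heights 0, 2, …, 2(n − 1) that must be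
-- shifted along itself by m cells. Take as potential the sum of |y| over all tiles, a
-- carried tile counting at the agent's position: lifting or placing a tile does not
-- change it and a move changes it by at most 2, while the target exceeds the initial
-- shape by 2mn. Tile sets are predicates, so the potential is evaluated on duplicate-free
-- enumerations of them; any two of these are permutations of each other.
module Submission where

open import Defs
open import Data.Nat using (ℕ; _*_; _∸_; _≤_)
open import Data.Product using (Σ; _×_)

open import Data.Bool using (true; false)
open import Data.Integer as ℤ using (+_)
import Data.Integer.Properties as ℤP
open import Data.List using (List; []; _∷_; map; filter; length)
open import Data.List.Membership.DecPropositional _≟ₙ_ using (_∈?_)
open import Data.List.Membership.Propositional using (_∈_)
open import Data.List.Membership.Propositional.Properties using (∈-filter⁺; ∈-filter⁻)
open import Data.List.Membership.Propositional.Properties.WithK using (unique∧set⇒bag)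
open import Data.List.Relation.Binary.BagAndSetEquality using (∼bag⇒↭)
open import Data.List.Relation.Binary.Permutation.Propositional using (_↭_)
import Data.List.Relation.Binary.Permutation.Propositional.Properties as ↭
import Data.List.Relation.Unary.All as All
open import Data.List.Relation.Unary.AllPairs using ([]; _∷_)
open import Data.List.Relation.Unary.Any using (here; there)
open import Data.List.Relation.Unary.Unique.Propositional using (Unique)
import Data.List.Relation.Unary.Unique.Propositional.Properties as Unique
open import Data.Nat as ℕ using (suc; zero; _+_; _<_; _≤′_; _≤‴_; z≤n; s≤s)
open import Data.Nat.DivMod using (m*n%n≡0)
open import Data.Nat.ListAction using (sum)
open import Data.Nat.ListAction.Properties using (sum-↭)
import Data.Nat.Properties as NP
open import Data.Nat.Tactic.RingSolver using (solve-∀)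
open import Data.Product using (_,_; proj₁; proj₂; ∃)
open import Data.Sum using (inj₁; inj₂)
open import Function using (_∘_; mk⇔)
open import Relation.Binary.Definitions using (DecidableEquality)
open import Relation.Binary.PropositionalEquality
open import Relation.Nullary using (yes; no; ¬?; does; contradiction)
open import Relation.Nullary.Decidable using (dec-true)
open import Relation.Unary as U using (_≐_; _⊆_)
open import Relation.Unary.Properties using (≐-trans; ≐-sym)

open import Algebra.Properties.CommutativeSemigroup NP.+-commutativeSemigroup using (x∙yz≈y∙xz)

private
  variable
    a b i j k l m n : ℕ
    p : Node
    A B : NodeSet
    P Q : Node → Set
    L L′ : List Node

module Removal {X : Set} (_≟_ : DecidableEquality X) where

  remove : X → List X → List X
  remove x = filter (¬? ∘ (_≟ x))

  module _ {x : X} {xs : List X} where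

    ∈-remove⁺ : ∀ {y} → y ∈ xs → y ≢ x → y ∈ remove x xs
    ∈-remove⁺ = ∈-filter⁺ (¬? ∘ (_≟ x))

    ∈-remove⁻ : ∀ {y} → y ∈ remove x xs → y ∈ xs × y ≢ x
    ∈-remove⁻ = ∈-filter⁻ (¬? ∘ (_≟ x))

    remove-unique : Unique xs → Unique (remove x xs)
    remove-unique = Unique.filter⁺ (¬? ∘ (_≟ x))

    remove-↭ : Unique xs → x ∈ xs → xs ↭ x ∷ remove x xs
    remove-↭ uniq x∈xs =
      ∼bag⇒↭ (unique∧set⇒bag uniq (x∉ ∷ remove-unique uniq) (mk⇔ to from))
      where
      x∉ : All.All (x ≢_) (remove x xs)
      x∉ = All.tabulate λ y∈ x≡y → proj₂ (∈-remove⁻ y∈) (sym x≡y)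
      to : ∀ {y} → y ∈ xs → y ∈ x ∷ remove x xs
      to {y} y∈ with y ≟ x
      ... | yes refl = here refl
      ... | no y≢x = there (∈-remove⁺ y∈ y≢x)
      from : ∀ {y} → y ∈ x ∷ remove x xs → y ∈ xs
      from (here refl) = x∈xs
      from (there y∈) = proj₁ (∈-remove⁻ y∈)

open Removal _≟ₙ_

Enumerates : NodeSet → List Node → Set
Enumerates A L = Unique L × (_∈ₛ A) ≐ (_∈ L)

enumerations-↭ : Enumerates A L → Enumerates A L′ → L ↭ L′
enumerations-↭ (uniq , A⊆L , L⊆A) (uniq′ , A⊆L′ , L′⊆A) =
  ∼bag⇒↭ (unique∧set⇒bag uniq uniq′ (mk⇔ (A⊆L′ ∘ L⊆A) (A⊆L ∘ L′⊆A)))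

Enumerates-upd-true : Enumerates A L → A p ≡ false → Enumerates (upd A p true) (p ∷ L)
Enumerates-upd-true {A} {L} {p} (uniq , A⊆L , L⊆A) p∉A = p∉L ∷ uniq , to , from
  where
  p∉L : All.All (p ≢_) L
  p∉L = All.tabulate λ { v∈L refl → contradiction (trans (sym p∉A) (L⊆A v∈L)) λ () }
  to : ∀ {v} → upd A p true v ≡ true → v ∈ p ∷ L
  to {v} v∈ with v ≟ₙ p
  ... | yes refl = here refl
  ... | no _ = there (A⊆L v∈)
  from : ∀ {v} → v ∈ p ∷ L → upd A p true v ≡ true
  from {v} v∈ with v ≟ₙ p | v∈
  ... | yes _ | _ = refl
  ... | no v≢p | here v≡p = contradiction v≡p v≢p
  ... | no _ | there v∈L = L⊆A v∈L

Enumerates-upd-false : Enumerates A L → ∀ p → Enumerates (upd A p false) (remove p L)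
Enumerates-upd-false {A} {L} (uniq , A⊆L , L⊆A) p = remove-unique uniq , to , from
  where
  to : ∀ {v} → upd A p false v ≡ true → v ∈ remove p L
  to {v} v∈ with v ≟ₙ p
  ... | no v≢p = ∈-remove⁺ (A⊆L v∈) v≢p
  from : ∀ {v} → v ∈ remove p L → upd A p false v ≡ true
  from {v} v∈ with ∈-remove⁻ v∈ | v ≟ₙ p
  ... | _ , v≢p | yes v≡p = contradiction v≡p v≢p
  ... | v∈L , _ | no _ = L⊆A v∈L

height : Node → ℕ
height (_ , y) = ℤ.∣ y ∣

height-vec≤2 : ∀ d → height (vec d) ≤ 2
height-vec≤2 N  = NP.≤-refl
height-vec≤2 NE = s≤s z≤n
height-vec≤2 SE = s≤s z≤n
height-vec≤2 S  = NP.≤-refl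
height-vec≤2 SW = s≤s z≤n
height-vec≤2 NW = s≤s z≤n

height-step : ∀ p d → height (p ⊕ vec d) ≤ 2 + height p
height-step (_ , y) d = begin
  ℤ.∣ y ℤ.+ dy ∣      ≤⟨ ℤP.∣i+j∣≤∣i∣+∣j∣ y dy ⟩
  ℤ.∣ y ∣ + ℤ.∣ dy ∣  ≤⟨ NP.+-monoʳ-≤ ℤ.∣ y ∣ (height-vec≤2 d) ⟩
  ℤ.∣ y ∣ + 2         ≡⟨ NP.+-comm ℤ.∣ y ∣ 2 ⟩
  2 + ℤ.∣ y ∣         ∎
  where
  open NP.≤-Reasoning
  dy = proj₂ (vec d)

weight : List Node → ℕ
weight = sum ∘ map height

weight-↭ : L ↭ L′ → weight L ≡ weight L′
weight-↭ = sum-↭ ∘ ↭.map⁺ height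

carriedHeight : Config → ℕ
carriedHeight ⟨ _ , p , true ⟩ = height p
carriedHeight ⟨ _ , _ , false ⟩ = 0

potential : Config → List Node → ℕ
potential c L = carriedHeight c + weight L

step-potential : ∀ {c c′} → Step c c′ → Enumerates (tiles c) L →
                 ∃ λ L′ → Enumerates (tiles c′) L′ × potential c′ L′ ≤ 2 + potential c L
step-potential {L} (move {p = p} {c = true} (d , refl)) enum =
  L , enum , NP.+-monoˡ-≤ (weight L) (height-step p d)
step-potential {L} (move {c = false} _) enum = L , enum , NP.m≤n+m (weight L) 2
step-potential {L} (lift {p = p} p∈) enum@(uniq , A⊆L , _) =
  remove p L , Enumerates-upd-false enum p ,
  NP.≤-trans (NP.≤-reflexive (sym (weight-↭ (remove-↭ uniq (A⊆L p∈)))))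
             (NP.m≤n+m (weight L) 2)
step-potential {L} (place {p = p} p∉) enum =
  p ∷ L , Enumerates-upd-true enum p∉ , NP.m≤n+m (height p + weight L) 2

run-potential : ∀ {c d} → Run c d k → Enumerates (tiles c) L → Enumerates (tiles d) L′ →
                potential d L′ ≤ k * 2 + potential c L
run-potential {c = c} (done _) enum enum′ =
  NP.≤-reflexive (cong (λ w → carriedHeight c + w) (weight-↭ (enumerations-↭ enum′ enum)))
run-potential {suc k} {L} {L′} {c} {d} (step {c' = c′} _ s r) enum enum′
  with L₁ , enum₁ , s-bound ← step-potential s enum = begin
    potential d L′              ≤⟨ run-potential r enum₁ enum′ ⟩
    k * 2 + potential c′ L₁     ≤⟨ NP.+-monoʳ-≤ (k * 2) s-bound ⟩
    k * 2 + (2 + potential c L) ≡⟨ x∙yz≈y∙xz (k * 2) 2 (potential c L) ⟩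
    suc k * 2 + potential c L   ∎
  where open NP.≤-Reasoning

cell : ℕ → Node
cell i = (+ 0 , + (i * 2))

cell-injective : cell i ≡ cell j → i ≡ j
cell-injective {i} {j} eq = NP.*-cancelʳ-≡ i j 2 (ℤP.+-injective (cong proj₂ eq))

cell∈V : ∀ i → InV (cell i)
cell∈V i = m*n%n≡0 i 2

cell-S : ∀ i → cell (suc i) ≡ cell i ⊕ vec S
cell-S i = cong (λ y → (+ 0 , + y)) (NP.+-comm 2 (i * 2))

Cells : ℕ → ℕ → Node → Set
Cells a b v = ∃ λ i → a ≤ i × i < b × v ≡ cell i

column : ℕ → ℕ → List Node
column a zero = []
column a (suc l) = cell a ∷ column (suc a) l

column-≐ : ∀ a l → (_∈ column a l) ≐ Cells a (a + l)
column-≐ a l = to a l , from a l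
  where
  to : ∀ a l → (_∈ column a l) ⊆ Cells a (a + l)
  to a (suc l) (here refl) = a , NP.≤-refl , NP.m<m+n a (s≤s z≤n) , refl
  to a (suc l) (there v∈) with i , a<i , i<b , refl ← to (suc a) l v∈ =
    i , NP.<⇒≤ a<i , subst (i <_) (sym (NP.+-suc a l)) i<b , refl
  from : ∀ a l → Cells a (a + l) ⊆ (_∈ column a l)
  from a zero (i , a≤i , i<a+0 , refl) =
    contradiction (NP.≤-<-trans a≤i i<a+0) (NP.n≮n a ∘ subst (a <_) (NP.+-identityʳ a))
  from a (suc l) (i , a≤i , i<b , refl) with a ℕ.≟ i
  ... | yes refl = here refl
  ... | no a≢i =
    there (from (suc a) l (i , NP.≤∧≢⇒< a≤i a≢i , subst (i <_) (NP.+-suc a l) i<b , refl))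

column-unique : ∀ a l → Unique (column a l)
column-unique a zero = []
column-unique a (suc l) = All.tabulate cell-a∉ ∷ column-unique (suc a) l
  where
  cell-a∉ : ∀ {v} → v ∈ column (suc a) l → cell a ≢ v
  cell-a∉ v∈ eq with _ , a<i , _ , refl ← proj₁ (column-≐ (suc a) l) v∈ =
    NP.<-irrefl (cell-injective eq) a<i

length-column : ∀ a l → length (column a l) ≡ l
length-column a zero = refl
length-column a (suc l) = cong suc (length-column (suc a) l)

weight-column-shift : ∀ a m l → weight (column (a + m) l) ≡ l * m * 2 + weight (column a l)
weight-column-shift a m zero = refl
weight-column-shift a m (suc l) = begin
  (a + m) * 2 + weight (column (suc a + m) l)
    ≡⟨ cong (λ w → (a + m) * 2 + w) (weight-column-shift (suc a) m l) ⟩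
  (a + m) * 2 + (l * m * 2 + weight (column (suc a) l))
    ≡⟨ rearrange a m l (weight (column (suc a) l)) ⟩
  suc l * m * 2 + (a * 2 + weight (column (suc a) l))
    ∎
  where
  open ≡-Reasoning
  rearrange : ∀ a m l w → (a + m) * 2 + (l * m * 2 + w) ≡ suc l * m * 2 + (a * 2 + w)
  rearrange = solve-∀

module _ {A : NodeSet} {a b : ℕ} (Cells⊆A : Cells a b ⊆ (_∈ₛ A)) where

  ascending-path : a ≤ i → i ≤‴ j → j < b → PathIn A (cell i) (cell j)
  ascending-path a≤i ℕ.≤‴-refl j<b = here (Cells⊆A (_ , a≤i , j<b , refl))
  ascending-path {i} a≤i (ℕ.≤‴-step i<j) j<b =
    there (Cells⊆A (_ , a≤i , NP.<-trans (NP.≤‴⇒≤ i<j) j<b , refl)) (S , cell-S i)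
      (ascending-path (NP.m≤n⇒m≤1+n a≤i) i<j j<b)

  descending-path : a ≤ i → i ≤′ j → j < b → PathIn A (cell j) (cell i)
  descending-path a≤i ℕ.≤′-refl j<b = here (Cells⊆A (_ , a≤i , j<b , refl))
  descending-path a≤i (ℕ.≤′-step i≤j) j<b =
    there (Cells⊆A (_ , NP.m≤n⇒m≤1+n (NP.≤-trans a≤i (NP.≤′⇒≤ i≤j)) , j<b , refl)) (N , refl)
      (descending-path a≤i i≤j (NP.<⇒≤ j<b))

Cells-connected : (_∈ₛ A) ≐ Cells a b → Connected A
Cells-connected (A⊆Cells , Cells⊆A) _ _ u∈ v∈
  with i , a≤i , i<b , refl ← A⊆Cells u∈ | j , a≤j , j<b , refl ← A⊆Cells v∈
  with NP.≤-total i j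
... | inj₁ i≤j = ascending-path Cells⊆A a≤i (NP.≤⇒≤‴ i≤j) j<b
... | inj₂ j≤i = descending-path Cells⊆A a≤j (NP.≤⇒≤′ j≤i) i<b

Cells-⊆V : (_∈ₛ A) ⊆ Cells a b → SubsetV A
Cells-⊆V A⊆Cells _ v∈ with i , _ , _ , refl ← A⊆Cells v∈ = cell∈V i

column-enumerates : (_∈ₛ A) ≐ Cells a (a + l) → Enumerates A (column a l)
column-enumerates {a = a} {l} A≐ = column-unique a l , ≐-trans A≐ (≐-sym (column-≐ a l))

Cells-card : (_∈ₛ A) ≐ Cells a (a + l) → Card A l
Cells-card {a = a} {l} A≐ with uniq , A⊆ , ⊆A ← column-enumerates A≐ =
  column a l , uniq , length-column a l , λ _ → A⊆ , ⊆A

⟦_⟧ : List Node → NodeSet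
⟦ L ⟧ v = does (v ∈? L)

⟦⟧-≐ : ∀ L → (_∈ₛ ⟦ L ⟧) ≐ (_∈ L)
⟦⟧-≐ L = to , from
  where
  to : (_∈ₛ ⟦ L ⟧) ⊆ (_∈ L)
  to {v} v∈ with v ∈? L
  ... | yes v∈L = v∈L
  from : (_∈ L) ⊆ (_∈ₛ ⟦ L ⟧)
  from {v} = dec-true (v ∈? L)

≗⇒≐ : (∀ v → A v ≡ B v) → (_∈ₛ A) ≐ (_∈ₛ B)
≗⇒≐ A≗B = (λ {v} → trans (sym (A≗B v))) , (λ {v} → trans (A≗B v))

∩-≐ : (_∈ₛ A) ≐ P → (_∈ₛ B) ≐ Q → (_∈ₛ (A ∩ B)) ≐ (P U.∩ Q)
∩-≐ {A = A} {P = P} {B = B} {Q = Q} (A⊆P , P⊆A) (B⊆Q , Q⊆B) = to , from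
  where
  to : (_∈ₛ (A ∩ B)) ⊆ (P U.∩ Q)
  to {v} v∈ with A v in Av | B v in Bv
  to v∈ | true | true = A⊆P Av , B⊆Q Bv
  from : (P U.∩ Q) ⊆ (_∈ₛ (A ∩ B))
  from (Pv , Qv) rewrite P⊆A Pv | Q⊆B Qv = refl

∖-≐ : (_∈ₛ A) ≐ P → (_∈ₛ B) ≐ Q → (_∈ₛ (A ∖ B)) ≐ (P U.∩ U.∁ Q)
∖-≐ {A = A} {P = P} {B = B} {Q = Q} (A⊆P , P⊆A) (B⊆Q , Q⊆B) = to , from
  where
  to : (_∈ₛ (A ∖ B)) ⊆ (P U.∩ U.∁ Q)
  to {v} v∈ with A v in Av | B v in Bv
  to v∈ | true | false = A⊆P Av , λ Qv → contradiction (trans (sym Bv) (Q⊆B Qv)) λ ()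
  from : (P U.∩ U.∁ Q) ⊆ (_∈ₛ (A ∖ B))
  from {v} (Pv , ¬Qv) with B v in Bv
  ... | true = contradiction (B⊆Q Bv) ¬Qv
  ... | false rewrite P⊆A Pv = refl

Cells-∩ : m ≤ n → (Cells 0 n U.∩ Cells m (m + n)) ≐ Cells m n
Cells-∩ {m} {n} m≤n = to , from
  where
  to : (Cells 0 n U.∩ Cells m (m + n)) ⊆ Cells m n
  to ((i , _ , i<n , refl) , (j , m≤j , _ , eq)) with refl ← cell-injective {i} {j} eq =
    i , m≤j , i<n , refl
  from : Cells m n ⊆ (Cells 0 n U.∩ Cells m (m + n))
  from (i , m≤i , i<n , refl) =
    (i , z≤n , i<n , refl) , (i , m≤i , NP.<-≤-trans i<n (NP.m≤n+m n m) , refl)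

Cells-∖ : m ≤ n → (Cells 0 n U.∩ U.∁ (Cells m (m + n))) ≐ Cells 0 m
Cells-∖ {m} {n} m≤n = to , from
  where
  to : (Cells 0 n U.∩ U.∁ (Cells m (m + n))) ⊆ Cells 0 m
  to ((i , _ , i<n , refl) , ∉T) with m ℕ.≤? i
  ... | yes m≤i = contradiction (i , m≤i , NP.<-≤-trans i<n (NP.m≤n+m n m) , refl) ∉T
  ... | no m≰i = i , z≤n , NP.≰⇒> m≰i , refl
  from : Cells 0 m ⊆ (Cells 0 n U.∩ U.∁ (Cells m (m + n)))
  from (i , _ , i<m , refl) =
    (i , z≤n , NP.<-≤-trans i<m m≤n , refl) ,
    λ { (j , m≤j , _ , eq) → NP.<⇒≱ i<m (subst (m ≤_) (sym (cell-injective {i} {j} eq)) m≤j) }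

shiftedColumn : m < n → Instance n m
shiftedColumn {m} {n} m<n = record
  { I = Iₛ ; T = Tₛ ; p0 = cell 0
  ; I⊆V = Cells-⊆V (proj₁ I≐) ; T⊆V = Cells-⊆V (proj₁ T≐)
  ; I-conn = Cells-connected I≐ ; T-conn = Cells-connected T≐
  ; I-card = Cells-card I≐ ; T-card = Cells-card T≐
  ; I∩T-ne = cell m , proj₂ I∩T≐ (m , NP.≤-refl , m<n , refl)
  ; I∩T-conn = Cells-connected I∩T≐
  ; supply = Cells-card I∖T≐
  ; p0∈I = proj₂ I≐ (0 , z≤n , NP.≤-<-trans z≤n m<n , refl)
  }
  where
  Iₛ Tₛ : NodeSet
  Iₛ = ⟦ column 0 n ⟧
  Tₛ = ⟦ column m n ⟧
  I≐ : (_∈ₛ Iₛ) ≐ Cells 0 n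
  I≐ = ≐-trans (⟦⟧-≐ (column 0 n)) (column-≐ 0 n)
  T≐ : (_∈ₛ Tₛ) ≐ Cells m (m + n)
  T≐ = ≐-trans (⟦⟧-≐ (column m n)) (column-≐ m n)
  I∩T≐ : (_∈ₛ (Iₛ ∩ Tₛ)) ≐ Cells m n
  I∩T≐ = ≐-trans (∩-≐ I≐ T≐) (Cells-∩ (NP.<⇒≤ m<n))
  I∖T≐ : (_∈ₛ (Iₛ ∖ Tₛ)) ≐ Cells 0 m
  I∖T≐ = ≐-trans (∖-≐ I≐ T≐) (Cells-∖ (NP.<⇒≤ m<n))

shiftedColumn-lowerBound : (m<n : m < n) → Solves (shiftedColumn m<n) k → m * n ≤ k
shiftedColumn-lowerBound {m} {n} {k} m<n (d , run , tiles≗T) =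
  NP.*-cancelʳ-≤ (m * n) k 2 (NP.+-cancelʳ-≤ w (m * n * 2) (k * 2) (begin
    m * n * 2 + w               ≡⟨ cong (λ x → x * 2 + w) (NP.*-comm m n) ⟩
    n * m * 2 + w               ≡⟨ weight-column-shift 0 m n ⟨
    weight (column m n)         ≤⟨ NP.m≤n+m _ (carriedHeight d) ⟩
    potential d (column m n)    ≤⟨ run-potential run initial-enum final-enum ⟩
    k * 2 + w                   ∎))
  where
  open NP.≤-Reasoning
  w = weight (column 0 n)
  initial-enum : Enumerates ⟦ column 0 n ⟧ (column 0 n)
  initial-enum = column-unique 0 n , ⟦⟧-≐ (column 0 n)
  final-enum : Enumerates (tiles d) (column m n)
  final-enum = column-unique m n , ≐-trans (≗⇒≐ tiles≗T) (⟦⟧-≐ (column m n))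

theorem6 : Σ ℕ λ c → 1 ≤ c × ((n m : ℕ) → 2 ≤ n → 1 ≤ m → m ≤ n ∸ 1 →
             Σ (Instance n m) λ inst → (k : ℕ) → Solves inst k → m * n ≤ c * k)
-- The construction also works for m = 0 (then I = T).
theorem6 = 1 , NP.≤-refl , λ n m 2≤n _ m≤n∸1 →
  let m<n = NP.≤-<-trans m≤n∸1 (NP.∸-monoʳ-< (s≤s z≤n) (NP.<⇒≤ 2≤n)) in
  shiftedColumn m<n , λ k solves →
    subst (m * n ≤_) (sym (NP.*-identityˡ k)) (shiftedColumn-lowerBound m<n solves)
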